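{- Let $P$ be a distribution over $\{0,1\}^n$ that is $\varepsilon$-far from being supported by $m$ elements or fewer. Then the expected number of independent samples from $P$ that must be drawn until one obtains $m+1$ elements of the support that are pairwise $\frac12\varepsilon$-far is at most $1+2\varepsilon^{ -1}m$.
   Context: On strings $d$ is the normalized Hamming distance; between distributions $d$ is the earth mover's distance (minimum over couplings of expected Hamming distance). $P$ is $\varepsilon$-far from being supported by at most $m$ elements if $d(P,Q)>\varepsilon$ for every distribution $Q$ with $|\mathrm{supp}(Q)|\le m$. Two strings are $\delta$-far if their normalized Hamming distance exceeds $\delta$.
   Formalization: The distribution P has only rational probabilities and the parameter ε is rational, and the distributions Q and couplings in the definition of being ε-far are taken rational-valued as well. -}

module Defs where

open import Data.Bool using (Bool; true; false; _∧_; _∨_; if_then_else_; _xor_)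
open import Data.Bool.ListAction using (all; any)
open import Data.Nat as ℕ using (ℕ; zero; suc)
open import Data.Integer using (+_)
open import Data.Vec using (Vec; []; _∷_)
open import Data.List as List using (List; []; _∷_; _++_; map; concatMap; length)
open import Data.List.Membership.Propositional using (_∈_)
open import Data.Rational using (ℚ; 0ℚ; 1ℚ; _+_; _*_; _/_; _<_; _≤_; ½; 1/_; Positive)
open import Data.Rational.Properties using (_<?_; pos⇒nonZero)
open import Data.Product using (Σ; _×_; ∃)
open import Relation.Nullary using (¬_; does)
open import Relation.Binary.PropositionalEquality using (_≡_)

Str : ℕ → Set
Str n = Vec Bool n

allStrs : (n : ℕ) → List (Str n)
allStrs zero    = [] ∷ []
allStrs (suc n) = concatMap (λ v → (false ∷ v) ∷ (true ∷ v) ∷ []) (allStrs n)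

sumℚ : List ℚ → ℚ
sumℚ = List.foldr _+_ 0ℚ

Σstr : (n : ℕ) → (Str n → ℚ) → ℚ
Σstr n f = sumℚ (map f (allStrs n))

ham : {n : ℕ} → Str n → Str n → ℕ
ham []       []       = 0
ham (a ∷ xs) (b ∷ ys) = (if a xor b then 1 else 0) ℕ.+ ham xs ys

-- normalized Hamming distance ham(x,y)/n  (for n = 0 there is a single string, distance 0)
dist : {n : ℕ} → Str n → Str n → ℚ
dist {zero}  x y = 0ℚ
dist {suc n} x y = (+ ham x y) / suc n

record IsDistribution (n : ℕ) (P : Str n → ℚ) : Set where
  field
    nonneg : ∀ x → 0ℚ ≤ P x
    total  : Σstr n P ≡ 1ℚ

SupportAtMost : {n : ℕ} → ℕ → (Str n → ℚ) → Set
SupportAtMost {n} m Q = Σ (List (Str n)) λ L → (length L ℕ.≤ m) × (∀ x → ¬ (Q x ≡ 0ℚ) → x ∈ L)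

record IsCoupling (n : ℕ) (P Q : Str n → ℚ) (C : Str n → Str n → ℚ) : Set where
  field
    nonneg : ∀ x y → 0ℚ ≤ C x y
    marg₁  : ∀ x → Σstr n (λ y → C x y) ≡ P x
    marg₂  : ∀ y → Σstr n (λ x → C x y) ≡ Q y

cost : (n : ℕ) → (Str n → Str n → ℚ) → ℚ
cost n C = Σstr n (λ x → Σstr n (λ y → C x y * dist x y))

EMD-gt : (n : ℕ) → (Str n → ℚ) → (Str n → ℚ) → ℚ → Set
EMD-gt n P Q ε = ∀ C → IsCoupling n P Q C → ε < cost n C

FarFromSupport : (n : ℕ) → (Str n → ℚ) → ℕ → ℚ → Set
FarFromSupport n P m ε =
  ∀ Q → IsDistribution n Q → SupportAtMost m Q → EMD-gt n P Q ε

farB : {n : ℕ} → ℚ → Str n → Str n → Bool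
farB δ x y = does (δ <? dist x y)

subsOf : {A : Set} → ℕ → List A → List (List A)
subsOf zero    xs       = [] ∷ []
subsOf (suc k) []       = []
subsOf (suc k) (x ∷ xs) = map (x ∷_) (subsOf k xs) ++ subsOf (suc k) xs

pairwiseFarB : {n : ℕ} → ℚ → List (Str n) → Bool
pairwiseFarB δ []       = true
pairwiseFarB δ (x ∷ xs) = all (farB δ x) xs ∧ pairwiseFarB δ xs

-- the samples contain m+1 elements that are pairwise δ-far
-- (pairwise δ-far with δ ≥ 0 forces them to be distinct)
goodB : {n : ℕ} → ℕ → ℚ → List (Str n) → Bool
goodB m δ s = any (pairwiseFarB δ) (subsOf (suc m) s)

allSeqs : (n k : ℕ) → List (List (Str n))
allSeqs n zero    = [] ∷ []
allSeqs n (suc k) = concatMap (λ s → map (_∷ s) (allStrs n)) (allSeqs n k)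

seqProb : {n : ℕ} → (Str n → ℚ) → List (Str n) → ℚ
seqProb P s = List.foldr (λ x r → P x * r) 1ℚ s

-- Pr[T > k] : the first k independent samples from P do NOT yet contain
-- m+1 pairwise δ-far elements
probNotYet : (n : ℕ) → (Str n → ℚ) → ℕ → ℚ → ℕ → ℚ
probNotYet n P m δ k =
  sumℚ (map (λ s → if goodB m δ s then 0ℚ else seqProb P s) (allSeqs n k))

-- Σ_{k < N} Pr[T > k]; E[T] = Σ_{k ≥ 0} Pr[T > k] (tail-sum formula,
-- with E[T] = ∞ when this series diverges)
partialExp : (n : ℕ) → (Str n → ℚ) → ℕ → ℚ → ℕ → ℚ
partialExp n P m δ zero    = 0ℚ
partialExp n P m δ (suc N) = partialExp n P m δ N + probNotYet n P m δ N

ExpectedStoppingTime≤ : (n : ℕ) → (Str n → ℚ) → ℕ → ℚ → ℚ → Set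
ExpectedStoppingTime≤ n P m δ B = ∀ N → partialExp n P m δ N ≤ B

inv : (ε : ℚ) → .{{Positive ε}} → ℚ
inv ε = (1/ ε) {{pos⇒nonZero ε}}

bound : (m : ℕ) (ε : ℚ) → .{{Positive ε}} → ℚ
bound m ε = 1ℚ + ((+ 2 / 1) * inv ε) * ((+ m) / 1)

{-# OPTIONS --safe #-}
-- Keep a sample when it is ½ε-far from every sample kept so far, up to m + 1 of them.
-- While the kept set K has 1 ≤ |K| ≤ m, sending each string to an element of K within ½ε
-- of it (to an arbitrary one if there is none) moves P onto K at cost at most
-- Pr[x is ½ε-far from K] + ½ε; as P is ε-far from distributions on K, a fresh sample is
-- kept with probability more than ½ε. The first sample is always kept, so the potential
-- 1 + (2/ε)m, lowered by 2/ε per kept sample and set to 0 once m + 1 pairwise far samples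
-- have appeared, is non-negative and drops in expectation by at least Pr[T > k] at step k;
-- summing over k bounds E[T] = Σₖ Pr[T > k].
module Submission where

open import Defs
open import Algebra.Bundles using (CommutativeMonoid)
open import Data.Bool as Bool using (Bool; true; false; T; not; _∧_; if_then_else_; _xor_)
open import Data.Bool.ListAction using (all)
open import Data.Bool.Properties using (T-∧; T-≡)
open import Data.Empty using (⊥-elim)
import Data.Integer as ℤ
import Data.Integer.Properties as ℤ
open import Data.List using (List; []; _∷_; _++_; map; concatMap; foldr; length)
open import Data.List.Membership.Propositional using (_∈_; lose)
open import Data.List.Membership.Propositional.Properties using (∈-map⁺)
open import Data.List.Relation.Binary.Sublist.Propositional using (_⊆_; []; _∷_; _∷ʳ_)
open import Data.List.Relation.Unary.Any using (here; there)
import Data.List.Relation.Unary.Any.Properties as Any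
open import Data.Nat as ℕ using (ℕ; zero; suc; z≤n; s≤s; _∸_; _<ᵇ_)
import Data.Nat.Properties as ℕ
open import Data.Product using (_,_)
open import Data.Rational using (ℚ; 0ℚ; 1ℚ; ½; _+_; _*_; _/_; _≤_; _<_; *≤*; Positive; nonNegative; toℚᵘ)
import Data.Rational.Properties as ℚ
import Data.Rational.Unnormalised as ℚᵘ
import Data.Rational.Unnormalised.Properties as ℚᵘ
open import Data.Rational.Solver using (module +-*-Solver)
open import Data.Vec using ([]; _∷_)
import Data.Vec.Properties as Vec
open import Function using (_∘_; Equivalence)
open import Relation.Binary.Definitions using (DecidableEquality)
open import Relation.Binary.PropositionalEquality
open import Relation.Nullary using (¬_; does; yes; no; contradiction)
open import Relation.Nullary.Decidable using (dec-true)

open import Algebra.Properties.CommutativeSemigroup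
  (CommutativeMonoid.commutativeSemigroup ℚ.+-0-commutativeMonoid) using (interchange)

𝟙 : Bool → ℚ
𝟙 true  = 1ℚ
𝟙 false = 0ℚ

0≤1 : 0ℚ ≤ 1ℚ
0≤1 = *≤* (ℤ.+≤+ z≤n)

p≤p+q : ∀ {p q} → 0ℚ ≤ q → p ≤ p + q
p≤p+q {p} 0≤q = subst (_≤ p + _) (ℚ.+-identityʳ p) (ℚ.+-monoʳ-≤ p 0≤q)

*-nonNeg : ∀ {p q} → 0ℚ ≤ p → 0ℚ ≤ q → 0ℚ ≤ p * q
*-nonNeg {p} {q} 0≤p 0≤q =
  ℚ.nonNegative⁻¹ _ {{ℚ.nonNeg*nonNeg⇒nonNeg p {{nonNegative 0≤p}} q {{nonNegative 0≤q}}}}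

*-monoˡ-≤-0≤ : ∀ {r p q} → 0ℚ ≤ r → p ≤ q → r * p ≤ r * q
*-monoˡ-≤-0≤ {r} 0≤r = ℚ.*-monoˡ-≤-nonNeg r {{nonNegative 0≤r}}

+[1+k]/1≡1+k/1 : ∀ k → ℤ.+ suc k / 1 ≡ 1ℚ + ℤ.+ k / 1
+[1+k]/1≡1+k/1 k = ℚ.toℚᵘ-injective (begin
  toℚᵘ (ℤ.+ suc k / 1)             ≈⟨ ℚ.toℚᵘ-fromℚᵘ (ℚᵘ.mkℚᵘ (ℤ.+ suc k) 0) ⟩
  ℚᵘ.mkℚᵘ (ℤ.+ suc k) 0            ≈⟨ ℚᵘ.*≡* cross-multiplied ⟩
  ℚᵘ.1ℚᵘ ℚᵘ.+ ℚᵘ.mkℚᵘ (ℤ.+ k) 0    ≈⟨ ℚᵘ.+-congʳ ℚᵘ.1ℚᵘ (ℚᵘ.≃-sym (ℚ.toℚᵘ-fromℚᵘ (ℚᵘ.mkℚᵘ (ℤ.+ k) 0))) ⟩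
  toℚᵘ 1ℚ ℚᵘ.+ toℚᵘ (ℤ.+ k / 1)    ≈⟨ ℚᵘ.≃-sym (ℚ.toℚᵘ-homo-+ 1ℚ (ℤ.+ k / 1)) ⟩
  toℚᵘ (1ℚ + ℤ.+ k / 1)            ∎)
  where
  open ℚᵘ.≃-Reasoning
  cross-multiplied : ℤ.+ suc k ℤ.* ℤ.+ 1 ≡ (ℤ.+ 1 ℤ.+ ℤ.+ k ℤ.* ℤ.+ 1) ℤ.* ℤ.+ 1
  cross-multiplied = trans (ℤ.*-identityʳ (ℤ.+ suc k))
    (sym (trans (ℤ.*-identityʳ _) (cong (ℤ._+_ ℤ.1ℤ) (ℤ.*-identityʳ (ℤ.+ k)))))

∑ : {A : Set} → List A → (A → ℚ) → ℚ
∑ xs f = sumℚ (map f xs)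

module _ {A : Set} where

  ∑-cong : ∀ xs {f g : A → ℚ} → (∀ x → f x ≡ g x) → ∑ xs f ≡ ∑ xs g
  ∑-cong []       f≗g = refl
  ∑-cong (x ∷ xs) f≗g = cong₂ _+_ (f≗g x) (∑-cong xs f≗g)

  ∑-zero : ∀ xs → ∑ xs (λ (_ : A) → 0ℚ) ≡ 0ℚ
  ∑-zero []       = refl
  ∑-zero (x ∷ xs) = trans (ℚ.+-identityˡ _) (∑-zero xs)

  ∑-++ : ∀ xs ys (f : A → ℚ) → ∑ (xs ++ ys) f ≡ ∑ xs f + ∑ ys f
  ∑-++ []       ys f = sym (ℚ.+-identityˡ _)
  ∑-++ (x ∷ xs) ys f = trans (cong (f x +_) (∑-++ xs ys f)) (sym (ℚ.+-assoc (f x) _ _))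

  ∑-+ : ∀ xs (f g : A → ℚ) → ∑ xs (λ x → f x + g x) ≡ ∑ xs f + ∑ xs g
  ∑-+ []       f g = sym (ℚ.+-identityʳ 0ℚ)
  ∑-+ (x ∷ xs) f g = trans (cong (f x + g x +_) (∑-+ xs f g)) (interchange (f x) (g x) _ _)

  ∑-*ˡ : ∀ xs c (f : A → ℚ) → ∑ xs (λ x → c * f x) ≡ c * ∑ xs f
  ∑-*ˡ []       c f = sym (ℚ.*-zeroʳ c)
  ∑-*ˡ (x ∷ xs) c f = trans (cong (c * f x +_) (∑-*ˡ xs c f)) (sym (ℚ.*-distribˡ-+ c (f x) _))

  ∑-mono-≤ : ∀ xs {f g : A → ℚ} → (∀ x → f x ≤ g x) → ∑ xs f ≤ ∑ xs g
  ∑-mono-≤ []       f≤g = ℚ.≤-refl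
  ∑-mono-≤ (x ∷ xs) f≤g = ℚ.+-mono-≤ (f≤g x) (∑-mono-≤ xs f≤g)

  ∑-nonNeg : ∀ xs {f : A → ℚ} → (∀ x → 0ℚ ≤ f x) → 0ℚ ≤ ∑ xs f
  ∑-nonNeg xs 0≤f = subst (_≤ ∑ xs _) (∑-zero xs) (∑-mono-≤ xs 0≤f)

module _ {A B : Set} where

  ∑-map : ∀ xs (g : A → B) (f : B → ℚ) → ∑ (map g xs) f ≡ ∑ xs (f ∘ g)
  ∑-map []       g f = refl
  ∑-map (x ∷ xs) g f = cong (f (g x) +_) (∑-map xs g f)

  ∑-concatMap : ∀ xs (g : A → List B) (f : B → ℚ) →
                ∑ (concatMap g xs) f ≡ ∑ xs (λ x → ∑ (g x) f)
  ∑-concatMap []       g f = refl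
  ∑-concatMap (x ∷ xs) g f =
    trans (∑-++ (g x) (concatMap g xs) f) (cong (∑ (g x) f +_) (∑-concatMap xs g f))

  ∑-comm : ∀ xs ys (f : A → B → ℚ) →
           ∑ xs (λ x → ∑ ys (f x)) ≡ ∑ ys (λ y → ∑ xs (λ x → f x y))
  ∑-comm []       ys f = sym (∑-zero ys)
  ∑-comm (x ∷ xs) ys f =
    trans (cong (∑ ys (f x) +_) (∑-comm xs ys f)) (sym (∑-+ ys (f x) (λ y → ∑ xs (λ x → f x y))))

_≟_ : ∀ {n} → DecidableEquality (Str n)
_≟_ = Vec.≡-dec Bool._≟_

Σstr-suc : ∀ n (f : Str (suc n) → ℚ) →
           Σstr (suc n) f ≡ Σstr n (λ v → f (false ∷ v) + (f (true ∷ v) + 0ℚ))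
Σstr-suc n f = ∑-concatMap (allStrs n) (λ v → (false ∷ v) ∷ (true ∷ v) ∷ []) f

Σstr-single : ∀ n (a : Str n) (g : Str n → ℚ) →
              Σstr n (λ y → if does (a ≟ y) then g y else 0ℚ) ≡ g a
Σstr-single zero    []          g = ℚ.+-identityʳ (g [])
Σstr-single (suc n) (false ∷ a) g = begin
  Σstr (suc n) _                                                  ≡⟨ Σstr-suc n _ ⟩
  Σstr n (λ v → (if does (a ≟ v) then g (false ∷ v) else 0ℚ) + (0ℚ + 0ℚ))
    ≡⟨ ∑-cong (allStrs n) (λ v → ℚ.+-identityʳ _) ⟩
  Σstr n (λ v → if does (a ≟ v) then g (false ∷ v) else 0ℚ)      ≡⟨ Σstr-single n a (g ∘ (false ∷_)) ⟩
  g (false ∷ a)                                                   ∎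
  where open ≡-Reasoning
Σstr-single (suc n) (true ∷ a) g = begin
  Σstr (suc n) _                                                  ≡⟨ Σstr-suc n _ ⟩
  Σstr n (λ v → 0ℚ + ((if does (a ≟ v) then g (true ∷ v) else 0ℚ) + 0ℚ))
    ≡⟨ ∑-cong (allStrs n) (λ v → trans (ℚ.+-identityˡ _) (ℚ.+-identityʳ _)) ⟩
  Σstr n (λ v → if does (a ≟ v) then g (true ∷ v) else 0ℚ)       ≡⟨ Σstr-single n a (g ∘ (true ∷_)) ⟩
  g (true ∷ a)                                                    ∎
  where open ≡-Reasoning

∑-allSeqs-suc : ∀ n k (f : List (Str n) → ℚ) →
                ∑ (allSeqs n (suc k)) f ≡ ∑ (allSeqs n k) (λ s → Σstr n (λ x → f (x ∷ s)))
∑-allSeqs-suc n k f = trans (∑-concatMap (allSeqs n k) (λ s → map (_∷ s) (allStrs n)) f)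
                            (∑-cong (allSeqs n k) (λ s → ∑-map (allStrs n) (_∷ s) f))

ham≤n : ∀ {n} (x y : Str n) → ham x y ℕ.≤ n
ham≤n []      []      = z≤n
ham≤n (a ∷ x) (b ∷ y) with a xor b
... | true  = s≤s (ham≤n x y)
... | false = ℕ.m≤n⇒m≤1+n (ham≤n x y)

dist≤1 : ∀ {n} (x y : Str n) → dist x y ≤ 1ℚ
dist≤1 {zero}  x y = 0≤1
dist≤1 {suc n} x y = ℚ.toℚᵘ-cancel-≤
  (ℚᵘ.≤-respˡ-≃ (ℚᵘ.≃-sym (ℚ.toℚᵘ-fromℚᵘ (ℚᵘ.mkℚᵘ (ℤ.+ ham x y) n))) (ℚᵘ.*≤* cross-multiplied))
  where
  open ℤ.≤-Reasoning
  cross-multiplied : ℤ.+ ham x y ℤ.* ℤ.+ 1 ℤ.≤ ℤ.+ 1 ℤ.* ℤ.+ suc n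
  cross-multiplied = begin
    ℤ.+ ham x y ℤ.* ℤ.+ 1  ≡⟨ ℤ.*-identityʳ _ ⟩
    ℤ.+ ham x y            ≤⟨ ℤ.+≤+ (ham≤n x y) ⟩
    ℤ.+ suc n              ≡⟨ ℤ.*-identityˡ _ ⟨
    ℤ.+ 1 ℤ.* ℤ.+ suc n    ∎

⊆⇒∈subsOf : ∀ {A : Set} {L s : List A} → L ⊆ s → L ∈ subsOf (length L) s
⊆⇒∈subsOf []                       = here refl
⊆⇒∈subsOf (_∷_ {x = x} refl L⊆s)   = Any.++⁺ˡ (∈-map⁺ (x ∷_) (⊆⇒∈subsOf L⊆s))
⊆⇒∈subsOf {L = []}    (y ∷ʳ L⊆s)   = here refl
⊆⇒∈subsOf {L = _ ∷ L} (y ∷ʳ L⊆s)   = Any.++⁺ʳ _ (⊆⇒∈subsOf L⊆s)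

module _ {n : ℕ} (m : ℕ) (δ : ℚ) where

  good-⊆ : ∀ {L s : List (Str n)} → L ⊆ s → length L ≡ suc m →
           T (pairwiseFarB δ L) → T (goodB m δ s)
  good-⊆ L⊆s |L|≡1+m farL =
    Any.any⁺ _ (lose (subst (λ k → _ ∈ subsOf k _) |L|≡1+m (⊆⇒∈subsOf L⊆s)) farL)

  good-∷ : ∀ x (s : List (Str n)) → T (goodB m δ s) → T (goodB m δ (x ∷ s))
  good-∷ x s good = Any.any⁺ _ (Any.++⁺ʳ (map (x ∷_) (subsOf m s)) (Any.any⁻ _ _ good))

  insert : Str n → List (Str n) → List (Str n)
  insert x ys = if (length ys <ᵇ suc m) ∧ all (farB δ x) ys then x ∷ ys else ys

  greedy : List (Str n) → List (Str n)
  greedy = foldr insert []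

  greedy-⊆ : ∀ s → greedy s ⊆ s
  greedy-⊆ []      = []
  greedy-⊆ (x ∷ s) with (length (greedy s) <ᵇ suc m) ∧ all (farB δ x) (greedy s)
  ... | true  = refl ∷ greedy-⊆ s
  ... | false = x ∷ʳ greedy-⊆ s

  greedy-pairwiseFar : ∀ s → T (pairwiseFarB δ (greedy s))
  greedy-pairwiseFar []      = _
  greedy-pairwiseFar (x ∷ s) with length (greedy s) <ᵇ suc m | all (farB δ x) (greedy s) in far
  ... | true  | true  = Equivalence.from T-∧ (Equivalence.from T-≡ far , greedy-pairwiseFar s)
  ... | true  | false = greedy-pairwiseFar s
  ... | false | _     = greedy-pairwiseFar s

  greedy-length≤ : ∀ s → length (greedy s) ℕ.≤ suc m
  greedy-length≤ []      = z≤n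
  greedy-length≤ (x ∷ s) with length (greedy s) <ᵇ suc m in lt | all (farB δ x) (greedy s)
  ... | true  | true  = ℕ.<ᵇ⇒< _ _ (Equivalence.from T-≡ lt)
  ... | true  | false = greedy-length≤ s
  ... | false | _     = greedy-length≤ s

  length-insert : ∀ x ys → length ys ℕ.< suc m →
                  length (insert x ys) ≡ (if all (farB δ x) ys then suc (length ys) else length ys)
  length-insert x ys |ys|<1+m with length ys <ᵇ suc m | ℕ.<⇒<ᵇ |ys|<1+m | all (farB δ x) ys
  ... | true | _ | true  = refl
  ... | true | _ | false = refl

  greedy-length≤m : ∀ s → ¬ T (goodB m δ s) → length (greedy s) ℕ.≤ m
  greedy-length≤m s notGood = ℕ.s≤s⁻¹ (ℕ.≤∧≢⇒< (greedy-length≤ s)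
    (λ full → notGood (good-⊆ (greedy-⊆ s) full (greedy-pairwiseFar s))))

module _ {n : ℕ} (δ : ℚ) where

  farB≡false⇒dist≤ : ∀ {x y : Str n} → farB δ x y ≡ false → dist x y ≤ δ
  farB≡false⇒dist≤ {x} {y} near =
    ℚ.≮⇒≥ λ δ<d → contradiction (trans (sym (dec-true (δ ℚ.<? dist x y) δ<d)) near) λ ()

  snap : Str n → List (Str n) → Str n → Str n
  snap y []       x = y
  snap y (z ∷ zs) x = if farB δ x y then snap z zs x else y

  snap-∈ : ∀ y zs x → snap y zs x ∈ y ∷ zs
  snap-∈ y []       x = here refl
  snap-∈ y (z ∷ zs) x with farB δ x y
  ... | true  = there (snap-∈ z zs x)
  ... | false = here refl

  dist-snap : 0ℚ ≤ δ → ∀ y zs x → dist x (snap y zs x) ≤ 𝟙 (all (farB δ x) (y ∷ zs)) + δ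
  dist-snap 0≤δ y []       x with farB δ x y in far
  ... | true  = ℚ.≤-trans (dist≤1 x y) (p≤p+q 0≤δ)
  ... | false = subst (dist x y ≤_) (sym (ℚ.+-identityˡ δ)) (farB≡false⇒dist≤ far)
  dist-snap 0≤δ y (z ∷ zs) x with farB δ x y in far
  ... | true  = dist-snap 0≤δ z zs x
  ... | false = subst (dist x y ≤_) (sym (ℚ.+-identityˡ δ)) (farB≡false⇒dist≤ far)

module _ {n : ℕ} {P : Str n → ℚ} (P-dist : IsDistribution n P) where
  open IsDistribution P-dist

  Σstr-P*const : ∀ a → Σstr n (λ x → P x * a) ≡ a
  Σstr-P*const a = begin
    Σstr n (λ x → P x * a)  ≡⟨ ∑-cong (allStrs n) (λ x → ℚ.*-comm (P x) a) ⟩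
    Σstr n (λ x → a * P x)  ≡⟨ ∑-*ˡ (allStrs n) a P ⟩
    a * Σstr n P            ≡⟨ cong (a *_) total ⟩
    a * 1ℚ                  ≡⟨ ℚ.*-identityʳ a ⟩
    a                       ∎
    where open ≡-Reasoning

  module _ (f : Str n → Str n) where

    graph : Str n → Str n → ℚ
    graph x y = if does (f x ≟ y) then P x else 0ℚ

    pushforward : Str n → ℚ
    pushforward y = Σstr n (λ x → graph x y)

    graph-nonNeg : ∀ x y → 0ℚ ≤ graph x y
    graph-nonNeg x y with f x ≟ y
    ... | yes _ = nonneg x
    ... | no  _ = ℚ.≤-refl

    Σstr-graph : ∀ x → Σstr n (graph x) ≡ P x
    Σstr-graph x = Σstr-single n (f x) (λ _ → P x)

    graph-isCoupling : IsCoupling n P pushforward graph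
    graph-isCoupling = record
      { nonneg = graph-nonNeg
      ; marg₁  = Σstr-graph
      ; marg₂  = λ _ → refl
      }

    pushforward-isDistribution : IsDistribution n pushforward
    pushforward-isDistribution = record
      { nonneg = λ y → ∑-nonNeg (allStrs n) (λ x → graph-nonNeg x y)
      ; total  = trans (sym (∑-comm (allStrs n) (allStrs n) graph))
                       (trans (∑-cong (allStrs n) Σstr-graph) total)
      }

    pushforward-supportAtMost : ∀ {m} (L : List (Str n)) → length L ℕ.≤ m → (∀ x → f x ∈ L) →
                                SupportAtMost m pushforward
    pushforward-supportAtMost L |L|≤m f∈L = L , |L|≤m , support⊆L
      where
      open import Data.List.Membership.DecPropositional (_≟_ {n}) using (_∈?_)
      support⊆L : ∀ y → ¬ pushforward y ≡ 0ℚ → y ∈ L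
      support⊆L y Qy≢0 with y ∈? L
      ... | yes y∈L = y∈L
      ... | no  y∉L = ⊥-elim (Qy≢0 (trans (∑-cong (allStrs n) graph≡0) (∑-zero (allStrs n))))
        where
        graph≡0 : ∀ x → graph x y ≡ 0ℚ
        graph≡0 x with f x ≟ y
        ... | yes refl = ⊥-elim (y∉L (f∈L x))
        ... | no  _    = refl

    cost-graph : cost n graph ≡ Σstr n (λ x → P x * dist x (f x))
    cost-graph = ∑-cong (allStrs n) λ x →
      trans (∑-cong (allStrs n) (graph*dist x)) (Σstr-single n (f x) (λ y → P x * dist x y))
      where
      graph*dist : ∀ x y → graph x y * dist x y ≡ (if does (f x ≟ y) then P x * dist x y else 0ℚ)
      graph*dist x y with f x ≟ y
      ... | yes _ = refl
      ... | no  _ = ℚ.*-zeroˡ (dist x y)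

  far⇒ε<transportCost : ∀ {m ε} → FarFromSupport n P m ε →
                        (f : Str n → Str n) (L : List (Str n)) → length L ℕ.≤ m → (∀ x → f x ∈ L) →
                        ε < Σstr n (λ x → P x * dist x (f x))
  far⇒ε<transportCost far f L |L|≤m f∈L = subst (_ <_) (cost-graph f)
    (far (pushforward f) (pushforward-isDistribution f) (pushforward-supportAtMost f L |L|≤m f∈L)
         (graph f) (graph-isCoupling f))

  farMass : ℚ → List (Str n) → ℚ
  farMass δ ys = Σstr n (λ x → P x * 𝟙 (all (farB δ x) ys))

  far⇒ε<farMass+δ : ∀ {m ε δ} → FarFromSupport n P m ε → 0ℚ ≤ δ →
                    ∀ y zs → length (y ∷ zs) ℕ.≤ m → ε < farMass δ (y ∷ zs) + δ
  far⇒ε<farMass+δ {ε = ε} {δ} far 0≤δ y zs |yzs|≤m = begin-strict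
    ε
      <⟨ far⇒ε<transportCost far (snap δ y zs) (y ∷ zs) |yzs|≤m (snap-∈ δ y zs) ⟩
    Σstr n (λ x → P x * dist x (snap δ y zs x))
      ≤⟨ ∑-mono-≤ (allStrs n) (λ x → *-monoˡ-≤-0≤ (nonneg x) (dist-snap δ 0≤δ y zs x)) ⟩
    Σstr n (λ x → P x * (𝟙 (far? x) + δ))
      ≡⟨ ∑-cong (allStrs n) (λ x → ℚ.*-distribˡ-+ (P x) _ δ) ⟩
    Σstr n (λ x → P x * 𝟙 (far? x) + P x * δ)
      ≡⟨ ∑-+ (allStrs n) _ _ ⟩
    farMass δ (y ∷ zs) + Σstr n (λ x → P x * δ)
      ≡⟨ cong (farMass δ (y ∷ zs) +_) (Σstr-P*const δ) ⟩
    farMass δ (y ∷ zs) + δ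
      ∎
    where
    open ℚ.≤-Reasoning
    far? : Str n → Bool
    far? x = all (farB δ x) (y ∷ zs)

  seqProb-nonNeg : ∀ s → 0ℚ ≤ seqProb P s
  seqProb-nonNeg []      = 0≤1
  seqProb-nonNeg (x ∷ s) = *-nonNeg (nonneg x) (seqProb-nonNeg s)

  expectation : (List (Str n) → ℚ) → ℕ → ℚ
  expectation Φ k = ∑ (allSeqs n k) (λ s → seqProb P s * Φ s)

  expectation-drift : (a Φ : List (Str n) → ℚ) →
                      (∀ s → a s + Σstr n (λ x → P x * Φ (x ∷ s)) ≤ Φ s) →
                      ∀ k → expectation a k + expectation Φ (suc k) ≤ expectation Φ k
  expectation-drift a Φ drift k = begin
    expectation a k + expectation Φ (suc k)
      ≡⟨ cong (expectation a k +_) (∑-allSeqs-suc n k _) ⟩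
    ∑ seqs (λ s → q s * a s) + ∑ seqs (λ s → Σstr n (λ x → (P x * q s) * Φ (x ∷ s)))
      ≡⟨ cong (expectation a k +_) (∑-cong seqs factor-q) ⟩
    ∑ seqs (λ s → q s * a s) + ∑ seqs (λ s → q s * next s)
      ≡⟨ ∑-+ seqs _ _ ⟨
    ∑ seqs (λ s → q s * a s + q s * next s)
      ≡⟨ ∑-cong seqs (λ s → ℚ.*-distribˡ-+ (q s) (a s) (next s)) ⟨
    ∑ seqs (λ s → q s * (a s + next s))
      ≤⟨ ∑-mono-≤ seqs (λ s → *-monoˡ-≤-0≤ (seqProb-nonNeg s) (drift s)) ⟩
    expectation Φ k ∎
    where
    open ℚ.≤-Reasoning
    open +-*-Solver
    seqs = allSeqs n k
    q    = seqProb P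
    next : List (Str n) → ℚ
    next s = Σstr n (λ x → P x * Φ (x ∷ s))
    factor-q : ∀ s → Σstr n (λ x → (P x * q s) * Φ (x ∷ s)) ≡ q s * next s
    factor-q s = trans (∑-cong (allStrs n) (λ x → solve 3 (λ p r φ → (p :* r) :* φ := r :* (p :* φ))
                                                          refl (P x) (q s) (Φ (x ∷ s))))
                       (∑-*ˡ (allStrs n) (q s) _)

  partialExp≤ : ∀ {m δ} (Φ : List (Str n) → ℚ) → (∀ s → 0ℚ ≤ Φ s) →
                (∀ s → 𝟙 (not (goodB m δ s)) + Σstr n (λ x → P x * Φ (x ∷ s)) ≤ Φ s) →
                ∀ N → partialExp n P m δ N ≤ Φ []
  partialExp≤ {m} {δ} Φ Φ-nonNeg drift N =
    ℚ.≤-trans (p≤p+q (∑-nonNeg (allSeqs n N) (λ s → *-nonNeg (seqProb-nonNeg s) (Φ-nonNeg s)))) (telescope N)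
    where
    notYet : List (Str n) → ℚ
    notYet s = 𝟙 (not (goodB m δ s))
    probNotYet≡ : ∀ k → probNotYet n P m δ k ≡ expectation notYet k
    probNotYet≡ k = ∑-cong (allSeqs n k) λ s → if-0≡*𝟙-not (goodB m δ s) (seqProb P s)
      where
      if-0≡*𝟙-not : ∀ b p → (if b then 0ℚ else p) ≡ p * 𝟙 (not b)
      if-0≡*𝟙-not true  p = sym (ℚ.*-zeroʳ p)
      if-0≡*𝟙-not false p = sym (ℚ.*-identityʳ p)
    telescope : ∀ N → partialExp n P m δ N + expectation Φ N ≤ Φ []
    telescope zero    = ℚ.≤-reflexive (trans (ℚ.+-identityˡ _) (trans (ℚ.+-identityʳ _) (ℚ.*-identityˡ _)))
    telescope (suc N) = begin
      (S + probNotYet n P m δ N) + expectation Φ (suc N)  ≡⟨ ℚ.+-assoc S _ _ ⟩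
      S + (probNotYet n P m δ N + expectation Φ (suc N))  ≡⟨ cong (λ p → S + (p + expectation Φ (suc N))) (probNotYet≡ N) ⟩
      S + (expectation notYet N + expectation Φ (suc N))  ≤⟨ ℚ.+-monoʳ-≤ S (expectation-drift notYet Φ drift N) ⟩
      S + expectation Φ N                                 ≤⟨ telescope N ⟩
      Φ []                                                ∎
      where
      open ℚ.≤-Reasoning
      S = partialExp n P m δ N

module Potential (n m : ℕ) (ε : ℚ) .{{_ : Positive ε}} (P : Str n → ℚ)
         (P-dist : IsDistribution n P) (far : FarFromSupport n P m ε) where
  open IsDistribution P-dist

  δ : ℚ
  δ = ½ * ε

  c : ℚ
  c = (ℤ.+ 2 / 1) * inv ε

  instance
    c>0 : Positive c
    c>0 = ℚ.pos*pos⇒pos (ℤ.+ 2 / 1) (inv ε) {{ℚ.1/pos⇒pos ε}}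

  0≤δ : 0ℚ ≤ δ
  0≤δ = ℚ.<⇒≤ (ℚ.positive⁻¹ δ {{ℚ.pos*pos⇒pos ½ ε}})

  δ+δ≡ε : δ + δ ≡ ε
  δ+δ≡ε = solve 1 (λ e → con ½ :* e :+ con ½ :* e := e) refl ε
    where open +-*-Solver

  c*δ≡1 : c * δ ≡ 1ℚ
  c*δ≡1 = trans (solve 4 (λ a b d e → (a :* b) :* (d :* e) := (a :* d) :* (b :* e))
                         refl (ℤ.+ 2 / 1) (inv ε) ½ ε)
                (cong ((ℤ.+ 2 / 1 * ½) *_) (ℚ.*-inverseˡ ε {{ℚ.pos⇒nonZero ε}}))
    where open +-*-Solver

  1<c*farMass : ∀ y zs → length (y ∷ zs) ℕ.≤ m → 1ℚ < c * farMass P-dist δ (y ∷ zs)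
  1<c*farMass y zs |yzs|≤m = subst (_< c * F) c*δ≡1 (ℚ.*-monoʳ-<-pos c δ<F)
    where
    F = farMass P-dist δ (y ∷ zs)
    δ<F : δ < F
    δ<F = ℚ.≰⇒> λ F≤δ → ℚ.<-irrefl refl
      (ℚ.<-≤-trans (far⇒ε<farMass+δ P-dist far 0≤δ y zs |yzs|≤m)
                   (subst (F + δ ≤_) δ+δ≡ε (ℚ.+-monoˡ-≤ δ F≤δ)))

  potential : ℕ → ℚ
  potential zero    = bound m ε
  potential (suc i) = c * (ℤ.+ (m ∸ i) / 1)

  potential-nonNeg : ∀ j → 0ℚ ≤ potential j
  potential-nonNeg zero    = ℚ.+-mono-≤ 0≤1 (potential-nonNeg 1)
  potential-nonNeg (suc i) =
    *-nonNeg (ℚ.<⇒≤ (ℚ.positive⁻¹ c)) (ℚ.nonNegative⁻¹ _ {{ℚ.normalize-nonNeg (m ∸ i) 1}})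

  potential-suc : ∀ {L} → suc L ℕ.≤ m → potential (suc L) ≡ c + potential (suc (suc L))
  potential-suc {L} 1+L≤m = begin
    c * (ℤ.+ (m ∸ L) / 1)                         ≡⟨ cong (λ k → c * (ℤ.+ k / 1)) (ℕ.+-∸-assoc 1 1+L≤m) ⟩
    c * (ℤ.+ suc (m ∸ suc L) / 1)                 ≡⟨ cong (c *_) (+[1+k]/1≡1+k/1 (m ∸ suc L)) ⟩
    c * (1ℚ + ℤ.+ (m ∸ suc L) / 1)                ≡⟨ ℚ.*-distribˡ-+ c 1ℚ _ ⟩
    c * 1ℚ + potential (suc (suc L))              ≡⟨ cong (_+ potential (suc (suc L))) (ℚ.*-identityʳ c) ⟩
    c + potential (suc (suc L))                   ∎
    where open ≡-Reasoning

  potential-if : ∀ b {L} → suc L ℕ.≤ m →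
                 potential (if b then suc (suc L) else suc L) + c * 𝟙 b ≡ potential (suc L)
  potential-if true  {L} 1+L≤m = trans (cong (potential (suc (suc L)) +_) (ℚ.*-identityʳ c))
                                       (trans (ℚ.+-comm _ c) (sym (potential-suc 1+L≤m)))
  potential-if false {L} 1+L≤m = trans (cong (potential (suc L) +_) (ℚ.*-zeroʳ c)) (ℚ.+-identityʳ _)

  potential-drift : ∀ ys → length ys ℕ.≤ m →
                    1ℚ + Σstr n (λ x → P x * potential (length (insert m δ x ys))) ≤ potential (length ys)
  potential-drift []          _      = ℚ.≤-reflexive (cong (1ℚ +_) (Σstr-P*const P-dist (potential 1)))
  potential-drift ys@(y ∷ zs) |ys|≤m = ℚ.<⇒≤ (begin-strict
    1ℚ + E                                        <⟨ ℚ.+-monoˡ-< E (1<c*farMass y zs |ys|≤m) ⟩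
    c * farMass P-dist δ ys + E                   ≡⟨ ℚ.+-comm _ E ⟩
    E + c * farMass P-dist δ ys                   ≡⟨ cong (E +_) (∑-*ˡ (allStrs n) c _) ⟨
    E + Σstr n (λ x → c * (P x * 𝟙 (far? x)))     ≡⟨ ∑-+ (allStrs n) _ _ ⟨
    Σstr n (λ x → P x * potential (length (insert m δ x ys)) + c * (P x * 𝟙 (far? x)))
                                                  ≡⟨ ∑-cong (allStrs n) pointwise ⟩
    Σstr n (λ x → P x * potential (length ys))    ≡⟨ Σstr-P*const P-dist _ ⟩
    potential (length ys)                         ∎)
    where
    open ℚ.≤-Reasoning
    open +-*-Solver
    far? : Str n → Bool
    far? x = all (farB δ x) ys
    E : ℚ
    E = Σstr n (λ x → P x * potential (length (insert m δ x ys)))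
    pointwise : ∀ x → P x * potential (length (insert m δ x ys)) + c * (P x * 𝟙 (far? x)) ≡
                      P x * potential (length ys)
    pointwise x = begin-equality
      P x * potential (length (insert m δ x ys)) + c * (P x * 𝟙 (far? x))
        ≡⟨ solve 4 (λ p φ k b → p :* φ :+ k :* (p :* b) := p :* (φ :+ k :* b))
                   refl (P x) (potential (length (insert m δ x ys))) c (𝟙 (far? x)) ⟩
      P x * (potential (length (insert m δ x ys)) + c * 𝟙 (far? x))
        ≡⟨ cong (λ j → P x * (potential j + c * 𝟙 (far? x))) (length-insert m δ x ys (s≤s |ys|≤m)) ⟩
      P x * (potential (if far? x then suc (length ys) else length ys) + c * 𝟙 (far? x))
        ≡⟨ cong (P x *_) (potential-if (far? x) |ys|≤m) ⟩
      P x * potential (length ys)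
        ∎

  Φ : List (Str n) → ℚ
  Φ s = if goodB m δ s then 0ℚ else potential (length (greedy m δ s))

  Φ≤potential : ∀ s → Φ s ≤ potential (length (greedy m δ s))
  Φ≤potential s with goodB m δ s
  ... | true  = potential-nonNeg (length (greedy m δ s))
  ... | false = ℚ.≤-refl

  Φ-nonNeg : ∀ s → 0ℚ ≤ Φ s
  Φ-nonNeg s with goodB m δ s
  ... | true  = ℚ.≤-refl
  ... | false = potential-nonNeg (length (greedy m δ s))

  Φ-good : ∀ s → T (goodB m δ s) → Φ s ≡ 0ℚ
  Φ-good s good with goodB m δ s
  ... | true  = refl
  ... | false = ⊥-elim good

  Φ-drift : ∀ s → 𝟙 (not (goodB m δ s)) + Σstr n (λ x → P x * Φ (x ∷ s)) ≤ Φ s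
  Φ-drift s with goodB m δ s in good
  ... | true  = ℚ.≤-reflexive
    (trans (ℚ.+-identityˡ _) (trans (∑-cong (allStrs n) P*Φ∷s≡0) (∑-zero (allStrs n))))
    where
    P*Φ∷s≡0 : ∀ x → P x * Φ (x ∷ s) ≡ 0ℚ
    P*Φ∷s≡0 x = trans (cong (P x *_) (Φ-good (x ∷ s) (good-∷ m δ x s (Equivalence.from T-≡ good))))
                      (ℚ.*-zeroʳ (P x))
  ... | false = ℚ.≤-trans
    (ℚ.+-monoʳ-≤ 1ℚ (∑-mono-≤ (allStrs n) λ x → *-monoˡ-≤-0≤ (nonneg x) (Φ≤potential (x ∷ s))))
    (potential-drift (greedy m δ s) (greedy-length≤m m δ s (subst T good)))

mainTheorem16 : (n m : ℕ) (ε : ℚ) .{{εpos : Positive ε}} (P : Str n → ℚ) →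
    IsDistribution n P → FarFromSupport n P m ε →
    ExpectedStoppingTime≤ n P m (½ * ε) (bound m ε)
mainTheorem16 n m ε P P-dist far = partialExp≤ P-dist Φ Φ-nonNeg Φ-drift
  where open Potential n m ε P P-dist far
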